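{- Let $n\ge2$, $m\ge1$, let $v$ be a vertex of the dYoke graph $Z_{n,m}$, let $P$ be a pivot path of $v$ with word $f_d\cdots f_1$, and let $I$ be a $P$-interval. Then for all $i,j$ with $[i,i+1]\subseteq I$ and $[j,j+1]\subseteq I$, the instances of $s_i$ and of $s_j$ in $f_d\cdots f_1$ all shift in the same direction (i.e., it is not the case that some $\overleftarrow{s}_i$ and some $\overrightarrow{s}_j$ both occur).
   Context: Elements of $\mathbb{Z}_n$ are identified with their smallest nonnegative representatives in $\{0,\dots,n-1\}$. The dYoke graph $Z_{n,m}$ has as vertices all tuples $u=(u_0,\dots,u_{m+1})$ with $u_0,u_{m+1}\in\mathbb{Z}_n$, $u_1,\dots,u_m\in\{ -1,0,1\}$ and $\sum_{i=0}^{m+1}u_i\equiv0\pmod n$; adjacency: there is $0\le i\le m$ with $u_j=v_j$ for $j\notin\{i,i+1\}$ and either ($u_i=v_i+1$, $u_{i+1}=v_{i+1}-1$) or ($u_i=v_i-1$, $u_{i+1}=v_{i+1}+1$), arithmetic in coordinates $0,m+1$ in $\mathbb{Z}_n$. $0$ is the all-zero vertex. For $0\le i\le m$, $\overleftarrow{s}_i(v)$ is obtained from $v$ by adding $1$ to entry $i$ and subtracting $1$ from entry $i+1$ if the result is a vertex (and is $v$ otherwise); $\overrightarrow{s}_i(v)$ subtracts $1$ from entry $i$ and adds $1$ to entry $i+1$; an instance of $s_i$ is an occurrence of $\overleftarrow{s}_i$ or $\overrightarrow{s}_i$. The word of a path $v^0\sim\dots\sim v^d$ is $f_d\cdots f_1$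 with $f_t(v^{t-1})=v^t$. For a path $P$ from $v$ to $0$ with word $w$: $0\le p\le m$ is an inner wall if neither $\overleftarrow{s}_p$ nor $\overrightarrow{s}_p$ occurs in $w$; $-1$ is a wall if $\overleftarrow{s}_0$ does not occur in $w$; $m+1$ is a wall if $\overrightarrow{s}_m$ does not occur in $w$. A $p$-pivot path of $v$ is a shortest path among all paths from $v$ to $0$ having $p$ as a wall; a pivot path is a $p$-pivot path for some $p$. If $p_1<\dots<p_t$ are the inner walls of a pivot path $P$, set $p_0=-1$, $p_{t+1}=m+1$; the $P$-intervals are the integer intervals $[p_k+1,p_{k+1}]$ for $0\le k\le t$. -}

module Defs where

open import Data.Nat as ℕ using (ℕ; zero; suc; _≡ᵇ_)
open import Data.Integer as ℤ using (ℤ; +_; -[1+_]; _-_; _≤_; _<_; 0ℤ; 1ℤ; -1ℤ)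
open import Data.Integer.Divisibility using (_∣_)
open import Data.Fin using (Fin; toℕ; inject₁; fromℕ)
import Data.Fin as F
open import Data.Bool using (if_then_else_)
open import Data.List using (List; []; _∷_; length)
open import Data.List.Membership.Propositional using (_∈_)
open import Data.Product using (Σ; _×_; ∃)
open import Data.Sum using (_⊎_)
open import Relation.Binary.PropositionalEquality using (_≡_)
open import Relation.Nullary using (¬_)

-- Coordinates of a vertex of Z_{n,m} are indexed by Fin (2 + m): 0, …, m+1.
-- A (raw) tuple is a function Fin (2+m) → ℤ; coordinates 0 and m+1 hold the
-- smallest nonnegative representative of an element of ℤ_n.
Tuple : ℕ → Set
Tuple m = Fin (suc (suc m)) → ℤ

sumℤ : ∀ {k} → (Fin k → ℤ) → ℤ
sumℤ {zero}  u = 0ℤ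
sumℤ {suc k} u = u F.zero ℤ.+ sumℤ (λ x → u (F.suc x))

Endpoint : (m : ℕ) → Fin (suc (suc m)) → Set
Endpoint m k = toℕ k ≡ 0 ⊎ toℕ k ≡ suc m

IsVertex : (n m : ℕ) → Tuple m → Set
IsVertex n m u =
  (∀ k → Endpoint m k → (0ℤ ≤ u k) × (u k < + n))
  × (∀ k → ¬ Endpoint m k → (-1ℤ ≤ u k) × (u k ≤ 1ℤ))
  × ((+ n) ∣ sumℤ u)

CoordEq : (n m : ℕ) → Fin (suc (suc m)) → ℤ → ℤ → Set
CoordEq n m k a b = (Endpoint m k → (+ n) ∣ (a - b)) × (¬ Endpoint m k → a ≡ b)

-- shiftL (←s_i): add 1 to entry i, subtract 1 from entry i+1;  shiftR (→s_i): the reverse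
data Dir : Set where
  shiftL shiftR : Dir

record Op (m : ℕ) : Set where
  constructor op
  field
    dir : Dir
    idx : Fin (suc m)
open Op public

sign : Dir → ℤ
sign shiftL = 1ℤ
sign shiftR = -1ℤ

delta : ∀ {m} → Op m → Fin (suc (suc m)) → ℤ
delta (op d i) k =
  if toℕ k ≡ᵇ toℕ i then sign d
  else if toℕ k ≡ᵇ suc (toℕ i) then ℤ.- sign d
  else 0ℤ

Step : (n m : ℕ) → Op m → Tuple m → Tuple m → Set
Step n m o u w = IsVertex n m w × (∀ k → CoordEq n m k (w k) (u k ℤ.+ delta o k))

-- PathTo0 n m u ws : the word ws (listed in order of application, i.e. the
-- word f_d ⋯ f_1 is the list f_1 ∷ … ∷ f_d ∷ []) is the word of a path from u
-- to the all-zero vertex.  A path is determined by its start and its word.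
data PathTo0 (n m : ℕ) : Tuple m → List (Op m) → Set where
  here : ∀ {u} → (∀ k → u k ≡ 0ℤ) → PathTo0 n m u []
  step : ∀ {u o ws} (w : Tuple m) → Step n m o u w → PathTo0 n m w ws →
         PathTo0 n m u (o ∷ ws)

-- possible walls: -1, inner p ∈ {0..m}, m+1
data WallPos (m : ℕ) : Set where
  left  : WallPos m
  inner : Fin (suc m) → WallPos m
  right : WallPos m

IsWall : ∀ {m} → List (Op m) → WallPos m → Set
IsWall {m} ws left      = ¬ (op shiftL F.zero ∈ ws)
IsWall {m} ws (inner p) = ¬ (op shiftL p ∈ ws) × ¬ (op shiftR p ∈ ws)
IsWall {m} ws right     = ¬ (op shiftR (fromℕ m) ∈ ws)

InnerWall : ∀ {m} → List (Op m) → Fin (suc m) → Set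
InnerWall ws p = IsWall ws (inner p)

IsPPivotPath : (n m : ℕ) → Tuple m → WallPos m → List (Op m) → Set
IsPPivotPath n m v p ws =
  PathTo0 n m v ws × IsWall ws p
  × (∀ ws' → PathTo0 n m v ws' → IsWall ws' p → length ws ℕ.≤ length ws')

IsPivotPath : (n m : ℕ) → Tuple m → List (Op m) → Set
IsPivotPath n m v ws = Σ (WallPos m) λ p → IsPPivotPath n m v p ws

-- [a , b] is a P-interval: a - 1 ∈ {-1} ∪ inner walls, b ∈ inner walls ∪ {m+1},
-- a - 1 < b, and no inner wall lies strictly between a - 1 and b (i.e. a-1 and b
-- are consecutive in the sequence p_0 = -1 < p_1 < … < p_t < p_{t+1} = m+1).
IsPInterval : ∀ {m} → List (Op m) → ℕ → ℕ → Set
IsPInterval {m} ws a b =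
  (a ≡ 0 ⊎ ∃ λ p → InnerWall ws p × suc (toℕ p) ≡ a)
  × (b ≡ suc m ⊎ ∃ λ p → InnerWall ws p × toℕ p ≡ b)
  × a ℕ.≤ b
  × (∀ p → InnerWall ws p → ¬ (a ℕ.≤ toℕ p × toℕ p ℕ.< b))

module Submission where

-- For a word ws on the positions 0 … m let
--   flow ws q = #←s_q − #→s_q,
-- the net number of units that ws moves across the edge between coordinates q and
-- q+1.  If ws is the word of a path from v to 0, the flow "drains" v: inner
-- coordinates satisfy v_k = flow(k−1) − flow(k), end coordinates the same modulo n.
-- In particular consecutive flow values differ by at most one.  Conversely every
-- draining flow G is *realised* by a path from v to 0 of length at most Σ_q |G q|
-- which uses ←s_q only where G q > 0 and →s_q only where G q < 0 (built greedily,
-- always shifting at a position where |G| is maximal).  Such a realisation of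
-- flow ws keeps every wall of ws.
-- On the other hand length ws = Σ_q (#←s_q + #→s_q) ≥ Σ_q |flow ws q|, strictly if
-- some edge q carries shifts in both directions (a reversal).  If a pivot path had
-- ←s_i and →s_j inside one P-interval, then either i or j is a reversal, or
-- flow i > 0 > flow j and the discrete intermediate value theorem yields a zero q
-- of the flow between them; q is not a wall, so it is a reversal.  The realisation
-- of flow ws would then be a strictly shorter path with the same walls.

open import Defs
open import Data.Nat using (ℕ; _≤_; suc)
open import Data.Fin using (Fin; toℕ)
open import Data.List using (List)
open import Data.List.Membership.Propositional using (_∈_)
open import Data.Product using (_×_)
open import Relation.Nullary using (¬_)

open import Data.Nat as ℕ using (zero; _<_; _≡ᵇ_; _≟_; NonZero; z≤n; s≤s; >-nonZero)
import Data.Nat.Properties as ℕP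
import Data.Nat.Divisibility as ℕD
open import Data.Fin as Fin using (fromℕ<)
import Data.Fin.Properties as FinP
open import Data.Integer as ℤ using (ℤ; +_; -[1+_]; 0ℤ; 1ℤ; -1ℤ; ∣_∣; +≤+; +<+; -≤+; -<+; -≤-)
import Data.Integer.Properties as ℤP
open import Data.Integer.DivMod using (_%ℕ_; _/ℕ_; a≡a%ℕn+[a/ℕn]*n; n%ℕd<d)
open import Data.Integer.Divisibility.Signed using (_∣_; divides; ∣m∣n⇒∣m+n; ∣m∣n⇒∣m-n; ∣ᵤ⇒∣; ∣⇒∣ᵤ)
open import Data.Integer.Solver using (module +-*-Solver)
open +-*-Solver using (solve; _:+_; _:-_; _:*_; :-_; _:=_; con)
import Algebra.Properties.CommutativeSemigroup as CommSemigroupProps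
open import Data.List using ([]; _∷_; length)
open import Data.List.Relation.Unary.Any using (here; there)
open import Data.Product using (Σ; _,_; proj₁; proj₂)
open import Data.Sum using (_⊎_; inj₁; inj₂)
open import Data.Bool using (true; false; if_then_else_)
open import Data.Empty using (⊥-elim)
open import Relation.Nullary using (Dec; yes; no)
open import Relation.Nullary.Decidable using (_⊎-dec_)
open import Relation.Binary.PropositionalEquality
open import Function using (_∘′_)
open import Relation.Binary.Definitions using (tri<; tri≈; tri>)

open CommSemigroupProps ℕP.+-commutativeSemigroup using () renaming (interchange to ℕ-interchange)
open CommSemigroupProps ℤP.+-commutativeSemigroup using () renaming (interchange to ℤ-interchange)

if-≡ᵇ-yes : ∀ {A : Set} {x y : ℕ} (a b : A) → x ≡ y → (if x ≡ᵇ y then a else b) ≡ a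
if-≡ᵇ-yes {x = x} {y} a b x≡y with x ≡ᵇ y | ℕP.≡⇒≡ᵇ x y x≡y
... | true  | _  = refl
... | false | ()

if-≡ᵇ-no : ∀ {A : Set} {x y : ℕ} (a b : A) → ¬ x ≡ y → (if x ≡ᵇ y then a else b) ≡ b
if-≡ᵇ-no {x = x} {y} a b x≢y with x ≡ᵇ y | ℕP.≡ᵇ⇒≡ x y
... | true  | ≡ᵇ⇒≡ = ⊥-elim (x≢y (≡ᵇ⇒≡ _))
... | false | _     = refl

-- |a − b| ≤ a + b for natural numbers, strictly when both are positive: a position
-- used in both directions wastes steps compared with its net flow.
∣a-b∣≤a+b : ∀ a b → ∣ + a ℤ.- + b ∣ ≤ a ℕ.+ b
∣a-b∣≤a+b a b = ℤP.∣i-j∣≤∣i∣+∣j∣ (+ a) (+ b)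

∣a-b∣<a+b : ∀ a b → 1 ≤ a → 1 ≤ b → ∣ + a ℤ.- + b ∣ < a ℕ.+ b
∣a-b∣<a+b (suc a) (suc b) _ _ = begin-strict
    ∣ + suc a ℤ.- + suc b ∣  ≡⟨ cong ∣_∣ cancel ⟩
    ∣ + a ℤ.- + b ∣          ≤⟨ ∣a-b∣≤a+b a b ⟩
    a ℕ.+ b                 <⟨ s≤s (ℕP.+-monoʳ-≤ a (ℕP.n≤1+n b)) ⟩
    suc a ℕ.+ suc b         ∎
  where
    open ℕP.≤-Reasoning
    cancel : + suc a ℤ.- + suc b ≡ + a ℤ.- + b
    cancel = trans (ℤP.m-n≡m⊖n (suc a) (suc b))
               (trans (ℤP.[1+m]⊖[1+n]≡m⊖n a b) (sym (ℤP.m-n≡m⊖n a b)))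

-- A shift in direction d at a position whose value z "agrees" with d moves z one
-- step towards zero (←s lowers a positive flow, →s raises a negative one).
Agrees : Dir → ℤ → Set
Agrees shiftL z = 0ℤ ℤ.< z
Agrees shiftR z = z ℤ.< 0ℤ

sign-of : (z : ℤ) → z ≡ 0ℤ ⊎ Σ Dir (λ d → Agrees d z)
sign-of (+ zero)  = inj₁ refl
sign-of (+ suc z) = inj₂ (shiftL , +<+ (s≤s z≤n))
sign-of -[1+ z ]  = inj₂ (shiftR , -<+)

agrees-shrinks : ∀ d z → Agrees d z → suc ∣ z ℤ.- sign d ∣ ≡ ∣ z ∣
agrees-shrinks shiftL (+ suc z)       _ = refl
agrees-shrinks shiftR -[1+ zero ]     _ = refl
agrees-shrinks shiftR -[1+ suc z ]    _ = refl
agrees-shrinks shiftL (+ zero)        (+<+ ())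
agrees-shrinks shiftR (+ z)           (+<+ ())

agrees-back : ∀ d d' z → Agrees d z → Agrees d' (z ℤ.- sign d) → Agrees d' z
agrees-back shiftL shiftL z        pos _         = pos
agrees-back shiftR shiftR z        neg _         = neg
agrees-back shiftL shiftR (+ suc z) _ (+<+ ())
agrees-back shiftR shiftL -[1+ zero ]  _ (+<+ ())
agrees-back shiftR shiftL -[1+ suc z ] _ ()
agrees-back shiftL shiftR (+ zero) (+<+ ()) _
agrees-back shiftR shiftL (+ z)    (+<+ ()) _

abs-peak-neg : ∀ {z x} → z ℤ.< 0ℤ → ∣ x ∣ ≤ ∣ z ∣ → z ℤ.≤ x
abs-peak-neg { -[1+ c ]} {+ k}     _ _          = -≤+
abs-peak-neg { -[1+ c ]} { -[1+ k ]} _ (s≤s k≤c) = -≤- k≤c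
abs-peak-neg {+ c}       (+<+ ()) _

abs-peak-pos : ∀ {z x} → 0ℤ ℤ.< z → ∣ x ∣ ≤ ∣ z ∣ → x ℤ.≤ z
abs-peak-pos {+ suc c} {+ k}      _ k≤z = +≤+ k≤z
abs-peak-pos {+ suc c} { -[1+ k ]} _ _   = -≤+
abs-peak-pos {+ zero}    (+<+ ()) _

small-multiple : ∀ {n a} → 0ℤ ℤ.≤ a → a ℤ.< + n → + n ∣ a → a ≡ 0ℤ
small-multiple {a = + zero}  _ _         _   = refl
small-multiple {a = + suc a} _ (+<+ a<n) n∣a = ⊥-elim (ℕP.<⇒≱ a<n (ℕD.∣⇒≤ (∣⇒∣ᵤ n∣a)))

sumUpTo : (ℕ → ℕ) → ℕ → ℕ
sumUpTo h zero    = h 0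
sumUpTo h (suc k) = sumUpTo h k ℕ.+ h (suc k)

sumUpTo-zeros : ∀ k → sumUpTo (λ _ → 0) k ≡ 0
sumUpTo-zeros zero    = refl
sumUpTo-zeros (suc k) = trans (ℕP.+-identityʳ _) (sumUpTo-zeros k)

sumUpTo-cong : ∀ {h h'} k → (∀ x → x ≤ k → h x ≡ h' x) → sumUpTo h k ≡ sumUpTo h' k
sumUpTo-cong zero    eq = eq 0 z≤n
sumUpTo-cong (suc k) eq =
  cong₂ ℕ._+_ (sumUpTo-cong k (λ x x≤k → eq x (ℕP.m≤n⇒m≤1+n x≤k))) (eq (suc k) ℕP.≤-refl)

sumUpTo-mono : ∀ {h h'} k → (∀ x → x ≤ k → h x ≤ h' x) → sumUpTo h k ≤ sumUpTo h' k
sumUpTo-mono zero    le = le 0 z≤n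
sumUpTo-mono (suc k) le =
  ℕP.+-mono-≤ (sumUpTo-mono k (λ x x≤k → le x (ℕP.m≤n⇒m≤1+n x≤k))) (le (suc k) ℕP.≤-refl)

sumUpTo-strict : ∀ {h h'} k q → (∀ x → x ≤ k → h x ≤ h' x) → q ≤ k → h q < h' q →
                 sumUpTo h k < sumUpTo h' k
sumUpTo-strict zero    .0 _  z≤n lt = lt
sumUpTo-strict (suc k) q  le q≤ lt with ℕP.m≤n⇒m<n∨m≡n q≤
... | inj₁ q<k+1 = ℕP.+-mono-<-≤ (sumUpTo-strict k q (λ x x≤k → le x (ℕP.m≤n⇒m≤1+n x≤k)) (ℕP.≤-pred q<k+1) lt)
                                 (le (suc k) ℕP.≤-refl)
... | inj₂ refl  = ℕP.+-mono-≤-< (sumUpTo-mono k (λ x x≤k → le x (ℕP.m≤n⇒m≤1+n x≤k))) lt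

sumUpTo-bump : ∀ {h h'} k q → q ≤ k → h' q ≡ suc (h q) → (∀ x → ¬ x ≡ q → h' x ≡ h x) →
               sumUpTo h' k ≡ suc (sumUpTo h k)
sumUpTo-bump zero .0 z≤n at _ = at
sumUpTo-bump {h} {h'} (suc k) q q≤ at off with ℕP.m≤n⇒m<n∨m≡n q≤
... | inj₁ q<k+1 = cong₂ ℕ._+_ (sumUpTo-bump k q (ℕP.≤-pred q<k+1) at off)
                               (off (suc k) (λ k+1≡q → ℕP.<-irrefl (sym k+1≡q) q<k+1))
... | inj₂ refl  = begin
    sumUpTo h' k ℕ.+ h' (suc k)     ≡⟨ cong₂ ℕ._+_ (sumUpTo-cong k (λ x x≤k → off x (λ { refl → ℕP.<-irrefl refl (s≤s x≤k) }))) at ⟩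
    sumUpTo h k ℕ.+ suc (h (suc k)) ≡⟨ ℕP.+-suc (sumUpTo h k) (h (suc k)) ⟩
    suc (sumUpTo h k ℕ.+ h (suc k)) ∎
  where open ≡-Reasoning

argmax : (h : ℕ → ℕ) (k : ℕ) → Σ ℕ λ q → q ≤ k × (∀ x → x ≤ k → h x ≤ h q)
argmax h zero = 0 , z≤n , λ { .0 z≤n → ℕP.≤-refl }
argmax h (suc k) with argmax h k
... | q , q≤k , max with h (suc k) ℕP.≤? h q
...   | yes last≤ = q , ℕP.m≤n⇒m≤1+n q≤k , bound
  where
    bound : ∀ x → x ≤ suc k → h x ≤ h q
    bound x x≤ with ℕP.m≤n⇒m<n∨m≡n x≤
    ... | inj₁ x<k+1 = max x (ℕP.≤-pred x<k+1)
    ... | inj₂ refl  = last≤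
...   | no last≰ = suc k , ℕP.≤-refl , bound
  where
    bound : ∀ x → x ≤ suc k → h x ≤ h (suc k)
    bound x x≤ with ℕP.m≤n⇒m<n∨m≡n x≤
    ... | inj₁ x<k+1 = ℕP.≤-trans (max x (ℕP.≤-pred x<k+1)) (ℕP.<⇒≤ (ℕP.≰⇒> last≰))
    ... | inj₂ refl  = ℕP.≤-refl

-- Flows are functions ℕ → ℤ, G q being the amount moved leftwards across the edge
-- (q, q+1).  Coordinate k receives G k from its right and loses G (k−1) to its left.
before : (ℕ → ℤ) → ℕ → ℤ
before G zero    = 0ℤ
before G (suc x) = G x

inflow : ∀ {K} → (ℕ → ℤ) → Fin K → ℤ
inflow G k = G (toℕ k) ℤ.- before G (toℕ k)

before-+ : ∀ G H t → before (λ x → G x ℤ.+ H x) t ≡ before G t ℤ.+ before H t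
before-+ G H zero    = refl
before-+ G H (suc x) = refl

before-- : ∀ G H t → before (λ x → G x ℤ.- H x) t ≡ before G t ℤ.- before H t
before-- G H zero    = refl
before-- G H (suc x) = refl

inflow-+ : ∀ {K} G H (k : Fin K) → inflow (λ x → G x ℤ.+ H x) k ≡ inflow G k ℤ.+ inflow H k
inflow-+ G H k = trans (cong (λ b → (G (toℕ k) ℤ.+ H (toℕ k)) ℤ.- b) (before-+ G H (toℕ k)))
  (solve 4 (λ g h g' h' → (g :+ h) :- (g' :+ h') := (g :- g') :+ (h :- h')) refl
     (G (toℕ k)) (H (toℕ k)) (before G (toℕ k)) (before H (toℕ k)))

inflow-- : ∀ {K} G H (k : Fin K) → inflow (λ x → G x ℤ.- H x) k ≡ inflow G k ℤ.- inflow H k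
inflow-- G H k = trans (cong (λ b → (G (toℕ k) ℤ.- H (toℕ k)) ℤ.- b) (before-- G H (toℕ k)))
  (solve 4 (λ g h g' h' → (g :- h) :- (g' :- h') := (g :- g') :- (h :- h')) refl
     (G (toℕ k)) (H (toℕ k)) (before G (toℕ k)) (before H (toℕ k)))

sumℤ-cong : ∀ {K} {a b : Fin K → ℤ} → (∀ x → a x ≡ b x) → sumℤ a ≡ sumℤ b
sumℤ-cong {zero}  eq = refl
sumℤ-cong {suc K} eq = cong₂ ℤ._+_ (eq Fin.zero) (sumℤ-cong (λ x → eq (Fin.suc x)))

sumℤ-+ : ∀ {K} (a b : Fin K → ℤ) → sumℤ (λ x → a x ℤ.+ b x) ≡ sumℤ a ℤ.+ sumℤ b
sumℤ-+ {zero}  a b = refl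
sumℤ-+ {suc K} a b =
  trans (cong (λ rest → (a Fin.zero ℤ.+ b Fin.zero) ℤ.+ rest) (sumℤ-+ (λ x → a (Fin.suc x)) (λ x → b (Fin.suc x))))
        (ℤ-interchange (a Fin.zero) (b Fin.zero) (sumℤ (λ x → a (Fin.suc x))) (sumℤ (λ x → b (Fin.suc x))))

sumℤ-∣ : ∀ {K} c (a : Fin K → ℤ) → (∀ x → c ∣ a x) → c ∣ sumℤ a
sumℤ-∣ {zero}  c a _   = divides 0ℤ refl
sumℤ-∣ {suc K} c a c∣a = ∣m∣n⇒∣m+n (c∣a Fin.zero) (sumℤ-∣ c (λ x → a (Fin.suc x)) (λ x → c∣a (Fin.suc x)))

sumℤ-inflow : ∀ K s (G : ℕ → ℤ) →
  sumℤ {K} (λ x → G (s ℕ.+ toℕ x) ℤ.- before G (s ℕ.+ toℕ x)) ≡ before G (s ℕ.+ K) ℤ.- before G s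
sumℤ-inflow zero s G rewrite ℕP.+-identityʳ s = sym (ℤP.+-inverseʳ (before G s))
sumℤ-inflow (suc K) s G = begin
    (G (s ℕ.+ 0) ℤ.- before G (s ℕ.+ 0)) ℤ.+ sumℤ {K} (λ x → G (s ℕ.+ suc (toℕ x)) ℤ.- before G (s ℕ.+ suc (toℕ x)))
  ≡⟨ cong₂ (λ t rest → (G t ℤ.- before G t) ℤ.+ rest) (ℕP.+-identityʳ s)
       (trans (sumℤ-cong {K} (λ x → cong (λ t → G t ℤ.- before G t) (ℕP.+-suc s (toℕ x)))) (sumℤ-inflow K (suc s) G)) ⟩
    (G s ℤ.- before G s) ℤ.+ (before G (suc s ℕ.+ K) ℤ.- G s)
  ≡⟨ solve 3 (λ g b r → (g :- b) :+ (r :- g) := r :- b) refl (G s) (before G s) (before G (suc s ℕ.+ K)) ⟩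
    before G (suc (s ℕ.+ K)) ℤ.- before G s
  ≡⟨ cong (λ t → before G t ℤ.- before G s) (sym (ℕP.+-suc s K)) ⟩
    before G (s ℕ.+ suc K) ℤ.- before G s
  ∎
  where open ≡-Reasoning

Lip : ℕ → (ℕ → ℤ) → Set
Lip m H = ∀ k → suc k ≤ m → (-1ℤ ℤ.≤ H k ℤ.- H (suc k)) × (H k ℤ.- H (suc k) ℤ.≤ 1ℤ)

Lip-cong : ∀ {m H H'} → (∀ x → H x ≡ H' x) → Lip m H → Lip m H'
Lip-cong eq lip k k<m =
  subst (λ d → (-1ℤ ℤ.≤ d) × (d ℤ.≤ 1ℤ)) (cong₂ ℤ._-_ (eq k) (eq (suc k))) (lip k k<m)

Lip-neg : ∀ {m H} → Lip m H → Lip m (λ x → ℤ.- H x)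
Lip-neg {H = H} lip k k<m with lip k k<m
... | lower , upper = subst (λ d → (-1ℤ ℤ.≤ d) × (d ℤ.≤ 1ℤ)) neg-diff (ℤP.neg-mono-≤ upper , ℤP.neg-mono-≤ lower)
  where
    neg-diff : ℤ.- (H k ℤ.- H (suc k)) ≡ ℤ.- H k ℤ.- ℤ.- H (suc k)
    neg-diff = solve 2 (λ a b → :- (a :- b) := (:- a) :- (:- b)) refl (H k) (H (suc k))

Lip-raise-min : ∀ {m H H'} q → (∀ x → x ≤ m → H q ℤ.≤ H x) → H' q ≡ H q ℤ.+ 1ℤ →
                (∀ x → ¬ x ≡ q → H' x ≡ H x) → Lip m H → Lip m H'
Lip-raise-min {H = H} {H'} q min raised same lip k k<m with lip k k<m | k ≟ q | suc k ≟ q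
... | _ | yes k≡q | yes k+1≡q = ⊥-elim (ℕP.1+n≢n (trans k+1≡q (sym k≡q)))
... | lower , _ | yes refl | no k+1≢q =
  subst (λ d → (-1ℤ ℤ.≤ d) × (d ℤ.≤ 1ℤ)) (sym diff)
    (ℤP.≤-trans lower (ℤP.i≤i+j _ 1ℤ) , ℤP.+-monoˡ-≤ 1ℤ (ℤP.i≤j⇒i-j≤0 (min (suc k) k<m)))
  where
    diff : H' k ℤ.- H' (suc k) ≡ (H k ℤ.- H (suc k)) ℤ.+ 1ℤ
    diff = trans (cong₂ ℤ._-_ raised (same (suc k) k+1≢q))
                 (solve 2 (λ a b → (a :+ con 1ℤ) :- b := (a :- b) :+ con 1ℤ) refl (H k) (H (suc k)))
... | _ , upper | no k≢q | yes refl =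
  subst (λ d → (-1ℤ ℤ.≤ d) × (d ℤ.≤ 1ℤ)) (sym diff)
    (ℤP.+-monoˡ-≤ -1ℤ (ℤP.i≤j⇒0≤j-i (min k (ℕP.<⇒≤ k<m))) , ℤP.i≤j⇒i-k≤j 1ℤ upper)
  where
    diff : H' k ℤ.- H' (suc k) ≡ (H k ℤ.- H (suc k)) ℤ.- 1ℤ
    diff = trans (cong₂ ℤ._-_ (same k k≢q) raised)
                 (solve 2 (λ a b → a :- (b :+ con 1ℤ) := (a :- b) :- con 1ℤ) refl (H k) (H (suc k)))
... | bounds | no k≢q | no k+1≢q =
  subst (λ d → (-1ℤ ℤ.≤ d) × (d ℤ.≤ 1ℤ)) (sym (cong₂ ℤ._-_ (same k k≢q) (same (suc k) k+1≢q))) bounds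

Lip-lower-max : ∀ {m H H'} q → (∀ x → x ≤ m → H x ℤ.≤ H q) → H' q ≡ H q ℤ.- 1ℤ →
                (∀ x → ¬ x ≡ q → H' x ≡ H x) → Lip m H → Lip m H'
Lip-lower-max {H = H} {H'} q max lowered same lip =
  Lip-cong (λ x → ℤP.neg-involutive (H' x))
    (Lip-neg {H = λ x → ℤ.- H' x}
      (Lip-raise-min {H = λ x → ℤ.- H x} q (λ x x≤m → ℤP.neg-mono-≤ (max x x≤m)) raised
         (λ x x≢q → cong ℤ.-_ (same x x≢q)) (Lip-neg {H = H} lip)))
  where
    raised : ℤ.- H' q ≡ ℤ.- H q ℤ.+ 1ℤ
    raised = trans (cong ℤ.-_ lowered) (solve 1 (λ a → :- (a :- con 1ℤ) := (:- a) :+ con 1ℤ) refl (H q))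

ivt : ∀ {m H} → Lip m H → ∀ x y → x ≤ y → y ≤ m → 0ℤ ℤ.< H x → H y ℤ.< 0ℤ →
      Σ ℕ λ q → x ≤ q × q < y × H q ≡ 0ℤ
ivt lip .0 zero z≤n _ pos neg = ⊥-elim (ℤP.<-asym pos neg)
ivt {H = H} lip x (suc y) x≤ y<m pos neg with ℕP.m≤n⇒m<n∨m≡n x≤
... | inj₂ refl = ⊥-elim (ℤP.<-asym pos neg)
... | inj₁ x<y+1 with ℤP.<-cmp (H y) 0ℤ
...   | tri≈ _ zero-at-y _ = y , ℕP.≤-pred x<y+1 , ℕP.n<1+n y , zero-at-y
...   | tri< neg-at-y _ _ with ivt lip x y (ℕP.≤-pred x<y+1) (ℕP.<⇒≤ y<m) pos neg-at-y
...     | q , x≤q , q<y , zero-at-q = q , x≤q , ℕP.m≤n⇒m≤1+n q<y , zero-at-q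
ivt {H = H} lip x (suc y) x≤ y<m pos neg | inj₁ _ | tri> _ _ pos-at-y =
  ⊥-elim (ℤP.<⇒≱ pos-at-y (no-jump (H y) (H (suc y)) (proj₂ (lip y y<m)) neg))
  where
    no-jump : ∀ a b → a ℤ.- b ℤ.≤ 1ℤ → b ℤ.< 0ℤ → a ℤ.≤ 0ℤ
    no-jump a b a-b≤1 b<0 = begin
      a                         ≡⟨ solve 2 (λ a b → a := (a :- b) :+ b) refl a b ⟩
      (a ℤ.- b) ℤ.+ b           ≤⟨ ℤP.+-mono-≤ a-b≤1 ℤP.≤-refl ⟩
      1ℤ ℤ.+ b                  ≤⟨ ℤP.i<j⇒suc[i]≤j b<0 ⟩
      0ℤ                        ∎
      where open ℤP.≤-Reasoning

sign-change-zero : ∀ {m H} → Lip m H → ∀ x y → x ≤ m → y ≤ m → 0ℤ ℤ.< H x → H y ℤ.< 0ℤ →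
                   Σ ℕ λ q → ((x ≤ q × q < y) ⊎ (y ≤ q × q < x)) × H q ≡ 0ℤ
sign-change-zero lip x y x≤m y≤m pos neg with ℕP.≤-total x y
... | inj₁ x≤y with ivt lip x y x≤y y≤m pos neg
...   | q , x≤q , q<y , zero-at-q = q , inj₁ (x≤q , q<y) , zero-at-q
sign-change-zero {H = H} lip x y x≤m y≤m pos neg | inj₂ y≤x
  with ivt (Lip-neg {H = H} lip) y x y≤x x≤m (ℤP.neg-mono-< neg) (ℤP.neg-mono-< pos)
... | q , y≤q , q<x , zero-of-neg =
  q , inj₂ (y≤q , q<x) , trans (sym (ℤP.neg-involutive (H q))) (cong ℤ.-_ zero-of-neg)

Between : ℕ → ℕ → ℕ → Set
Between a b x = a ≤ x × x < b

module Words (m : ℕ) where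

  opFlow : Op m → ℕ → ℤ
  opFlow (op d i) q = if q ≡ᵇ toℕ i then sign d else 0ℤ

  opFlow-at : ∀ d i → opFlow (op d i) (toℕ i) ≡ sign d
  opFlow-at d i = if-≡ᵇ-yes {x = toℕ i} (sign d) 0ℤ refl

  opFlow-off : ∀ d i x → ¬ x ≡ toℕ i → opFlow (op d i) x ≡ 0ℤ
  opFlow-off d i x x≢i = if-≡ᵇ-no (sign d) 0ℤ x≢i

  opFlow-beyond : ∀ o → opFlow o (suc m) ≡ 0ℤ
  opFlow-beyond (op d i) = opFlow-off d i (suc m) (λ m+1≡i → ℕP.<-irrefl (sym m+1≡i) (FinP.toℕ<n i))

  delta-inflow : ∀ o k → delta o k ≡ inflow (opFlow o) k
  delta-inflow (op d i) k with toℕ k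
  ... | zero = sym (ℤP.+-identityʳ _)
  ... | suc x with suc x ≟ toℕ i | x ≟ toℕ i
  ...   | yes x+1≡i | yes x≡i = ⊥-elim (ℕP.1+n≢n (trans x+1≡i (sym x≡i)))
  ...   | yes x+1≡i | no x≢i =
    trans (if-≡ᵇ-yes _ _ x+1≡i)
          (sym (trans (cong₂ ℤ._-_ (if-≡ᵇ-yes (sign d) 0ℤ x+1≡i) (if-≡ᵇ-no (sign d) 0ℤ x≢i)) (ℤP.+-identityʳ (sign d))))
  ...   | no x+1≢i | yes x≡i =
    trans (if-≡ᵇ-no _ _ x+1≢i) (trans (if-≡ᵇ-yes _ _ x≡i)
          (sym (trans (cong₂ ℤ._-_ (if-≡ᵇ-no (sign d) 0ℤ x+1≢i) (if-≡ᵇ-yes (sign d) 0ℤ x≡i)) (ℤP.+-identityˡ (ℤ.- sign d)))))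
  ...   | no x+1≢i | no x≢i =
    trans (if-≡ᵇ-no _ _ x+1≢i) (trans (if-≡ᵇ-no _ _ (x≢i ∘′ ℕP.suc-injective))
          (sym (cong₂ ℤ._-_ (if-≡ᵇ-no (sign d) 0ℤ x+1≢i) (if-≡ᵇ-no (sign d) 0ℤ x≢i))))

  flow : List (Op m) → ℕ → ℤ
  flow []       q = 0ℤ
  flow (o ∷ ws) q = opFlow o q ℤ.+ flow ws q

  flow-beyond : ∀ ws → flow ws (suc m) ≡ 0ℤ
  flow-beyond []       = refl
  flow-beyond (o ∷ ws) = cong₂ ℤ._+_ (opFlow-beyond o) (flow-beyond ws)

  same : Dir → Dir → ℕ
  same shiftL shiftL = 1
  same shiftR shiftR = 1
  same shiftL shiftR = 0
  same shiftR shiftL = 0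

  same-refl : ∀ d → same d d ≡ 1
  same-refl shiftL = refl
  same-refl shiftR = refl

  same-apart : ∀ d d' → ¬ d ≡ d' → same d d' ≡ 0
  same-apart shiftL shiftL d≢d' = ⊥-elim (d≢d' refl)
  same-apart shiftR shiftR d≢d' = ⊥-elim (d≢d' refl)
  same-apart shiftL shiftR _    = refl
  same-apart shiftR shiftL _    = refl

  occurs : Dir → ℕ → Op m → ℕ
  occurs d q (op d' i) = if q ≡ᵇ toℕ i then same d d' else 0

  count : Dir → List (Op m) → ℕ → ℕ
  count d []       q = 0
  count d (o ∷ ws) q = occurs d q o ℕ.+ count d ws q

  uses : List (Op m) → ℕ → ℕ
  uses ws q = count shiftL ws q ℕ.+ count shiftR ws q

  opFlow-occurs : ∀ o q → opFlow o q ≡ + occurs shiftL q o ℤ.- + occurs shiftR q o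
  opFlow-occurs (op d i) q with q ≡ᵇ toℕ i
  opFlow-occurs (op shiftL i) q | true  = refl
  opFlow-occurs (op shiftR i) q | true  = refl
  opFlow-occurs (op d i)      q | false = refl

  flow-count : ∀ ws q → flow ws q ≡ + count shiftL ws q ℤ.- + count shiftR ws q
  flow-count []       q = refl
  flow-count (o ∷ ws) q = begin
      opFlow o q ℤ.+ flow ws q
    ≡⟨ cong₂ ℤ._+_ (opFlow-occurs o q) (flow-count ws q) ⟩
      (+ l₁ ℤ.- + r₁) ℤ.+ (+ l ℤ.- + r)
    ≡⟨ solve 4 (λ l₁ r₁ l r → (l₁ :- r₁) :+ (l :- r) := (l₁ :+ l) :- (r₁ :+ r)) refl (+ l₁) (+ r₁) (+ l) (+ r) ⟩
      (+ l₁ ℤ.+ + l) ℤ.- (+ r₁ ℤ.+ + r)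
    ≡⟨ cong₂ ℤ._-_ (sym (ℤP.pos-+ l₁ l)) (sym (ℤP.pos-+ r₁ r)) ⟩
      + (l₁ ℕ.+ l) ℤ.- + (r₁ ℕ.+ r)
    ∎
    where
      open ≡-Reasoning
      l₁ = occurs shiftL q o
      r₁ = occurs shiftR q o
      l  = count shiftL ws q
      r  = count shiftR ws q

  occurs-both : ∀ d i q → occurs shiftL q (op d i) ℕ.+ occurs shiftR q (op d i) ≡ (if q ≡ᵇ toℕ i then 1 else 0)
  occurs-both d i q with q ≡ᵇ toℕ i
  occurs-both shiftL i q | true  = refl
  occurs-both shiftR i q | true  = refl
  occurs-both d      i q | false = refl

  uses-cons : ∀ o ws q → uses (o ∷ ws) q ≡ (occurs shiftL q o ℕ.+ occurs shiftR q o) ℕ.+ uses ws q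
  uses-cons o ws q = ℕ-interchange (occurs shiftL q o) (count shiftL ws q) (occurs shiftR q o) (count shiftR ws q)

  -- every operator of a word is one use of exactly one edge
  length-uses : ∀ ws → length ws ≡ sumUpTo (uses ws) m
  length-uses []             = sym (sumUpTo-zeros m)
  length-uses (op d i ∷ ws) =
    trans (cong suc (length-uses ws))
          (sym (sumUpTo-bump m (toℕ i) (ℕP.≤-pred (FinP.toℕ<n i)) at off))
    where
      at : uses (op d i ∷ ws) (toℕ i) ≡ suc (uses ws (toℕ i))
      at = trans (uses-cons (op d i) ws (toℕ i))
                 (cong (ℕ._+ uses ws (toℕ i)) (trans (occurs-both d i (toℕ i)) (if-≡ᵇ-yes {x = toℕ i} 1 0 refl)))
      off : ∀ x → ¬ x ≡ toℕ i → uses (op d i ∷ ws) x ≡ uses ws x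
      off x x≢i = trans (uses-cons (op d i) ws x)
                        (cong (ℕ._+ uses ws x) (trans (occurs-both d i x) (if-≡ᵇ-no 1 0 x≢i)))

  count-present : ∀ {d i ws} → op d i ∈ ws → 1 ≤ count d ws (toℕ i)
  count-present {d} {i} {_ ∷ ws} (here refl) =
    subst (λ c → 1 ≤ c ℕ.+ count d ws (toℕ i)) (sym (trans (if-≡ᵇ-yes {x = toℕ i} _ 0 refl) (same-refl d))) (s≤s z≤n)
  count-present {d} {i} {o ∷ ws} (there mem) = ℕP.≤-trans (count-present mem) (ℕP.m≤n+m _ (occurs d (toℕ i) o))

  count-absent : ∀ d i ws → ¬ (op d i ∈ ws) → count d ws (toℕ i) ≡ 0
  count-absent d i []              _      = refl
  count-absent d i (op d' i' ∷ ws) absent =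
    cong₂ ℕ._+_ occurs-not (count-absent d i ws (λ mem → absent (there mem)))
    where
      occurs-not : occurs d (toℕ i) (op d' i') ≡ 0
      occurs-not with toℕ i ≟ toℕ i'
      ... | no i≢i' = if-≡ᵇ-no _ 0 i≢i'
      ... | yes i≡i' with FinP.toℕ-injective i≡i'
      ...   | refl = trans (if-≡ᵇ-yes {x = toℕ i} _ 0 refl)
                           (same-apart d d' (λ d≡d' → absent (here (cong (λ e → op e i) d≡d'))))

  count-zero-absent : ∀ d i ws → count d ws (toℕ i) ≡ 0 → ¬ (op d i ∈ ws)
  count-zero-absent d i ws none mem = ℕP.<-irrefl refl (subst (1 ≤_) none (count-present mem))

  flow-no-left : ∀ ws q → count shiftL ws q ≡ 0 → flow ws q ≡ ℤ.- + count shiftR ws q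
  flow-no-left ws q none =
    trans (flow-count ws q) (trans (cong (λ l → + l ℤ.- + count shiftR ws q) none) (ℤP.+-identityˡ _))

  flow-no-right : ∀ ws q → count shiftR ws q ≡ 0 → flow ws q ≡ + count shiftL ws q
  flow-no-right ws q none =
    trans (flow-count ws q) (trans (cong (λ r → + count shiftL ws q ℤ.- + r) none) (ℤP.+-identityʳ _))

  Follows : (ℕ → ℤ) → List (Op m) → Set
  Follows G ws = ∀ d i → op d i ∈ ws → Agrees d (G (toℕ i))

  walls-kept : ∀ ws ws' p → Follows (flow ws) ws' → IsWall ws p → IsWall ws' p
  walls-kept ws ws' left follows noL mem =
    ℤP.<⇒≱ (follows shiftL Fin.zero mem)
      (subst (ℤ._≤ 0ℤ) (sym (flow-no-left ws 0 (count-absent shiftL Fin.zero ws noL))) ℤP.neg-≤-pos)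
  walls-kept ws ws' right follows noR mem =
    ℤP.<⇒≱ (follows shiftR (Fin.fromℕ m) mem)
      (subst (0ℤ ℤ.≤_) (sym (flow-no-right ws _ (count-absent shiftR (Fin.fromℕ m) ws noR))) (+≤+ z≤n))
  walls-kept ws ws' (inner p) follows (noL , noR) =
      (λ mem → ℤP.<-irrefl (sym zero-flow) (follows shiftL p mem))
    , (λ mem → ℤP.<-irrefl zero-flow (follows shiftR p mem))
    where
      zero-flow : flow ws (toℕ p) ≡ 0ℤ
      zero-flow = trans (flow-no-right ws _ (count-absent shiftR p ws noR)) (cong +_ (count-absent shiftL p ws noL))

  Reversal : List (Op m) → ℕ → Set
  Reversal ws q = q ≤ m × 1 ≤ count shiftL ws q × 1 ≤ count shiftR ws q

  -- |flow ws q| ≤ uses ws q for every q, strictly at a reversal; hence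
  -- a word with a reversal is longer than the total absolute flow.
  reversal-shortens : ∀ ws q → Reversal ws q → sumUpTo (λ x → ∣ flow ws x ∣) m < length ws
  reversal-shortens ws q (q≤m , some-left , some-right) =
    subst (sumUpTo (λ x → ∣ flow ws x ∣) m <_) (sym (length-uses ws))
      (sumUpTo-strict m q bound q≤m
        (subst (λ z → ∣ z ∣ < uses ws q) (sym (flow-count ws q)) (∣a-b∣<a+b _ _ some-left some-right)))
    where
      bound : ∀ x → x ≤ m → ∣ flow ws x ∣ ≤ uses ws x
      bound x _ = subst (λ z → ∣ z ∣ ≤ uses ws x) (sym (flow-count ws x)) (∣a-b∣≤a+b (count shiftL ws x) (count shiftR ws x))

  WallFree : List (Op m) → ℕ → ℕ → Set
  WallFree ws a b = ∀ p → InnerWall ws p → ¬ Between a b (toℕ p)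

  -- A zero of the flow in a wall-free range is a reversal: it is used, and used
  -- equally often in both directions.
  zero-reversal : ∀ ws {a b} → WallFree ws a b → ∀ q → q ≤ m → Between a b q → flow ws q ≡ 0ℤ →
                  Reversal ws q
  zero-reversal ws free q q≤m between zero-flow with count shiftL ws q ≟ 0
  ... | no some = q≤m , ℕP.n≢0⇒n>0 some , subst (1 ≤_) balanced (ℕP.n≢0⇒n>0 some)
    where
      balanced : count shiftL ws q ≡ count shiftR ws q
      balanced = ℤP.+-injective (ℤP.i-j≡0⇒i≡j _ _ (trans (sym (flow-count ws q)) zero-flow))
  ... | yes none = ⊥-elim (free qF (absent shiftL none , absent shiftR noneR) (subst (Between _ _) (sym q≡) between))
    where
      qF : Fin (suc m)
      qF = fromℕ< (s≤s q≤m)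
      q≡ : toℕ qF ≡ q
      q≡ = FinP.toℕ-fromℕ< (s≤s q≤m)
      noneR : count shiftR ws q ≡ 0
      noneR = ℤP.+-injective (trans (sym (ℤP.neg-involutive _)) (cong ℤ.-_ (trans (sym (flow-no-left ws q none)) zero-flow)))
      absent : ∀ d → count d ws q ≡ 0 → ¬ (op d qF ∈ ws)
      absent d zero-count = count-zero-absent d qF ws (trans (cong (count d ws) q≡) zero-count)

  index-bound : (i : Fin (suc m)) → toℕ i ≤ m
  index-bound i = ℕP.≤-pred (FinP.toℕ<n i)

  interval-reversal : ∀ ws {a b} (i j : Fin (suc m)) → Lip m (flow ws) → WallFree ws a b →
                      Between a b (toℕ i) → Between a b (toℕ j) →
                      op shiftL i ∈ ws → op shiftR j ∈ ws → Σ ℕ (Reversal ws)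
  interval-reversal ws i j lip free in-i in-j Li Rj
    with count shiftR ws (toℕ i) ≟ 0 | count shiftL ws (toℕ j) ≟ 0
  ... | no R-at-i | _ = toℕ i , index-bound i , count-present Li , ℕP.n≢0⇒n>0 R-at-i
  ... | yes _ | no L-at-j = toℕ j , index-bound j , ℕP.n≢0⇒n>0 L-at-j , count-present Rj
  ... | yes noR-at-i | yes noL-at-j
    with sign-change-zero lip (toℕ i) (toℕ j) (index-bound i) (index-bound j) positive negative
    where
      positive : 0ℤ ℤ.< flow ws (toℕ i)
      positive = subst (0ℤ ℤ.<_) (sym (flow-no-right ws _ noR-at-i)) (+<+ (count-present Li))
      negative : flow ws (toℕ j) ℤ.< 0ℤ
      negative = subst (ℤ._< 0ℤ) (sym (flow-no-left ws _ noL-at-j)) (ℤP.neg-mono-< (+<+ (count-present Rj)))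
  ...   | q , inj₁ (i≤q , q<j) , zero-flow =
    q , zero-reversal ws free q (ℕP.<⇒≤ (ℕP.<-≤-trans q<j (index-bound j))) (ℕP.≤-trans (proj₁ in-i) i≤q , ℕP.<-trans q<j (proj₂ in-j)) zero-flow
  ...   | q , inj₂ (j≤q , q<i) , zero-flow =
    q , zero-reversal ws free q (ℕP.<⇒≤ (ℕP.<-≤-trans q<i (index-bound i))) (ℕP.≤-trans (proj₁ in-j) j≤q , ℕP.<-trans q<i (proj₂ in-i)) zero-flow

  minus-opFlow-off : ∀ (G : ℕ → ℤ) d q x → ¬ x ≡ toℕ q → G x ℤ.- opFlow (op d q) x ≡ G x
  minus-opFlow-off G d q x x≢q = trans (cong (λ f → G x ℤ.- f) (opFlow-off d q x x≢q)) (ℤP.+-identityʳ (G x))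

  peak : (G : ℕ → ℤ) → Σ (Fin (suc m)) λ q → ∀ x → x ≤ m → ∣ G x ∣ ≤ ∣ G (toℕ q) ∣
  peak G with argmax (λ x → ∣ G x ∣) m
  ... | q , q≤m , max =
    fromℕ< (s≤s q≤m) , subst (λ t → ∀ x → x ≤ m → ∣ G x ∣ ≤ ∣ G t ∣) (sym (FinP.toℕ-fromℕ< (s≤s q≤m))) max

  -- Shifting at a peak of |G| in the agreeing direction keeps G 1-Lipschitz
  -- (a positive peak is a maximum, a negative one a minimum) …
  lip-shift : ∀ (G : ℕ → ℤ) d q → (∀ x → x ≤ m → ∣ G x ∣ ≤ ∣ G (toℕ q) ∣) → Agrees d (G (toℕ q)) →
              Lip m G → Lip m (λ x → G x ℤ.- opFlow (op d q) x)
  lip-shift G shiftL q is-peak agrees =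
    Lip-lower-max {H = G} (toℕ q) (λ x x≤m → abs-peak-pos agrees (is-peak x x≤m))
      (cong (λ f → G (toℕ q) ℤ.- f) (opFlow-at shiftL q)) (minus-opFlow-off G shiftL q)
  lip-shift G shiftR q is-peak agrees =
    Lip-raise-min {H = G} (toℕ q) (λ x x≤m → abs-peak-neg agrees (is-peak x x≤m))
      (cong (λ f → G (toℕ q) ℤ.- f) (opFlow-at shiftR q)) (minus-opFlow-off G shiftR q)

  shrink : ∀ (G : ℕ → ℤ) d q → Agrees d (G (toℕ q)) →
           sumUpTo (λ x → ∣ G x ∣) m ≡ suc (sumUpTo (λ x → ∣ G x ℤ.- opFlow (op d q) x ∣) m)
  shrink G d q agrees =
    sumUpTo-bump {h = λ x → ∣ G x ℤ.- opFlow (op d q) x ∣} {h' = λ x → ∣ G x ∣} m (toℕ q) (index-bound q) at off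
    where
      at : ∣ G (toℕ q) ∣ ≡ suc ∣ G (toℕ q) ℤ.- opFlow (op d q) (toℕ q) ∣
      at = sym (trans (cong (λ f → suc ∣ G (toℕ q) ℤ.- f ∣) (opFlow-at d q)) (agrees-shrinks d _ agrees))
      off : ∀ x → ¬ x ≡ toℕ q → ∣ G x ∣ ≡ ∣ G x ℤ.- opFlow (op d q) x ∣
      off x x≢q = cong ∣_∣ (sym (minus-opFlow-off G d q x x≢q))

  follows-cons : ∀ (G : ℕ → ℤ) d q ws → Agrees d (G (toℕ q)) →
                 Follows (λ x → G x ℤ.- opFlow (op d q) x) ws → Follows G (op d q ∷ ws)
  follows-cons G d q ws agrees follows .d .q (here refl) = agrees
  follows-cons G d q ws agrees follows d' i (there mem) with i FinP.≟ q
  ... | yes refl = agrees-back d d' (G (toℕ q)) agrees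
                     (subst (λ f → Agrees d' (G (toℕ q) ℤ.- f)) (opFlow-at d q) (follows d' q mem))
  ... | no i≢q = subst (Agrees d') (minus-opFlow-off G d q (toℕ i) (i≢q ∘′ FinP.toℕ-injective)) (follows d' i mem)

module Realisation (n m : ℕ) {{n≢0 : NonZero n}} where
  open Words m

  endpoint? : ∀ k → Dec (Endpoint m k)
  endpoint? k = (toℕ k ≟ 0) ⊎-dec (toℕ k ≟ suc m)

  Drains : Tuple m → (ℕ → ℤ) → Set
  Drains u G = ∀ k → (Endpoint m k → + n ∣ (u k ℤ.+ inflow G k)) × (¬ Endpoint m k → u k ℤ.+ inflow G k ≡ 0ℤ)

  drains-step : ∀ {u w o G G'} → (∀ k → CoordEq n m k (w k) (u k ℤ.+ delta o k)) →
                (∀ k → inflow G k ≡ delta o k ℤ.+ inflow G' k) →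
                (Drains u G → Drains w G') × (Drains w G' → Drains u G)
  drains-step {u} {w} {o} {G} {G'} coords split = forward , backward
    where
      gap : Fin (suc (suc m)) → ℤ
      gap k = w k ℤ.- (u k ℤ.+ delta o k)
      gap-end : ∀ k → Endpoint m k → + n ∣ gap k
      gap-end k e = ∣ᵤ⇒∣ (proj₁ (coords k) e)
      gap-inner : ∀ k → ¬ Endpoint m k → gap k ≡ 0ℤ
      gap-inner k ne = trans (cong (λ x → x ℤ.- (u k ℤ.+ delta o k)) (proj₂ (coords k) ne)) (ℤP.+-inverseʳ (u k ℤ.+ delta o k))
      balance : ∀ k → w k ℤ.+ inflow G' k ≡ (u k ℤ.+ inflow G k) ℤ.+ gap k
      balance k = sym (trans (cong (λ I → (u k ℤ.+ I) ℤ.+ gap k) (split k))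
        (solve 4 (λ w u δ I → (u :+ (δ :+ I)) :+ (w :- (u :+ δ)) := w :+ I) refl (w k) (u k) (delta o k) (inflow G' k)))
      balance' : ∀ k → u k ℤ.+ inflow G k ≡ (w k ℤ.+ inflow G' k) ℤ.- gap k
      balance' k = trans (solve 2 (λ a g → a := (a :+ g) :- g) refl (u k ℤ.+ inflow G k) (gap k))
                         (cong (ℤ._- gap k) (sym (balance k)))
      forward : Drains u G → Drains w G'
      forward drains k =
          (λ e → subst (+ n ∣_) (sym (balance k)) (∣m∣n⇒∣m+n (proj₁ (drains k) e) (gap-end k e)))
        , (λ ne → trans (balance k) (cong₂ ℤ._+_ (proj₂ (drains k) ne) (gap-inner k ne)))
      backward : Drains w G' → Drains u G
      backward drains k =
          (λ e → subst (+ n ∣_) (sym (balance' k)) (∣m∣n⇒∣m-n (proj₁ (drains k) e) (gap-end k e)))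
        , (λ ne → trans (balance' k) (cong₂ ℤ._-_ (proj₂ (drains k) ne) (gap-inner k ne)))

  inflow-vanishes : ∀ G → (∀ x → x ≤ suc m → G x ≡ 0ℤ) → (k : Fin (suc (suc m))) → inflow G k ≡ 0ℤ
  inflow-vanishes G vanishes k =
    cong₂ ℤ._-_ (vanishes (toℕ k) k≤m+1) (before-vanishes (toℕ k) k≤m+1)
    where
      k≤m+1 : toℕ k ≤ suc m
      k≤m+1 = ℕP.≤-pred (FinP.toℕ<n k)
      before-vanishes : ∀ t → t ≤ suc m → before G t ≡ 0ℤ
      before-vanishes zero    _   = refl
      before-vanishes (suc t) t<  = vanishes t (ℕP.m≤n⇒m≤1+n (ℕP.≤-pred t<))

  path-drains : ∀ {v ws} → PathTo0 n m v ws → Drains v (flow ws)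
  path-drains {v} (here v≡0) k = (λ _ → divides 0ℤ (trans zero-sum (sym (ℤP.*-zeroˡ (+ n))))) , (λ _ → zero-sum)
    where
      zero-sum : v k ℤ.+ inflow (flow []) k ≡ 0ℤ
      zero-sum = cong₂ ℤ._+_ (v≡0 k) (inflow-vanishes (flow []) (λ _ _ → refl) k)
  path-drains {v} (step {o = o} {ws = ws} w (_ , coords) p) =
    proj₂ (drains-step {v} {w} {o} {flow (o ∷ ws)} {flow ws} coords split) (path-drains p)
    where
      split : ∀ k → inflow (flow (o ∷ ws)) k ≡ delta o k ℤ.+ inflow (flow ws) k
      split k = trans (inflow-+ (opFlow o) (flow ws) k) (cong (ℤ._+ inflow (flow ws) k) (sym (delta-inflow o k)))

  inner-index : ∀ c → ¬ Endpoint m c → Σ ℕ λ k → toℕ c ≡ suc k × suc k ≤ m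
  inner-index c not-end with toℕ c in c≡ | FinP.toℕ<n c
  ... | zero  | _   = ⊥-elim (not-end (inj₁ refl))
  ... | suc k | c<  = k , refl , ℕP.≤-pred (ℕP.≤∧≢⇒< (ℕP.≤-pred c<) (λ k+1≡m+1 → not-end (inj₂ k+1≡m+1)))

  inner-coordinate : ∀ k → suc k ≤ m → Σ (Fin (suc (suc m))) λ c → toℕ c ≡ suc k × ¬ Endpoint m c
  inner-coordinate k k<m = c , c≡ , not-end
    where
      c : Fin (suc (suc m))
      c = fromℕ< (s≤s (ℕP.m≤n⇒m≤1+n k<m))
      c≡ : toℕ c ≡ suc k
      c≡ = FinP.toℕ-fromℕ< (s≤s (ℕP.m≤n⇒m≤1+n k<m))
      not-end : ¬ Endpoint m c
      not-end (inj₁ c≡0)   = ℕP.0≢1+n (trans (sym c≡0) c≡)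
      not-end (inj₂ c≡m+1) = ℕP.<-irrefl (ℕP.suc-injective (trans (sym c≡) c≡m+1)) k<m

  drained-inner : ∀ {u G} → Drains u G → ∀ c k → toℕ c ≡ suc k → ¬ Endpoint m c → u c ≡ G k ℤ.- G (suc k)
  drained-inner {u} {G} drains c k c≡ not-end = ℤP.i-j≡0⇒i≡j _ _ (begin
      u c ℤ.- (G k ℤ.- G (suc k))        ≡⟨ solve 3 (λ x a b → x :- (a :- b) := x :+ (b :- a)) refl (u c) (G k) (G (suc k)) ⟩
      u c ℤ.+ (G (suc k) ℤ.- G k)        ≡⟨ cong (λ t → u c ℤ.+ (G t ℤ.- before G t)) (sym c≡) ⟩
      u c ℤ.+ inflow G c                 ≡⟨ proj₂ (drains c) not-end ⟩
      0ℤ                                 ∎)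
    where open ≡-Reasoning

  -- The flow draining a vertex is 1-Lipschitz, since not-end coordinates lie in {−1, 0, 1}.
  vertex-lip : ∀ {u G} → IsVertex n m u → Drains u G → Lip m G
  vertex-lip {u} {G} (_ , inner-range , _) drains k k<m with inner-coordinate k k<m
  ... | c , c≡ , not-end =
    subst (λ x → (-1ℤ ℤ.≤ x) × (x ℤ.≤ 1ℤ)) (drained-inner {u} {G} drains c k c≡ not-end) (inner-range c not-end)

  -- The coordinates of a tuple drained by a flow vanishing at m+1 sum to a multiple of n,
  -- because the inflows telescope to 0.
  drained-sum : ∀ {u G} → Drains u G → G (suc m) ≡ 0ℤ → + n ∣ sumℤ u
  drained-sum {u} {G} drains G-end =
    subst (+ n ∣_) total (sumℤ-∣ (+ n) (λ k → u k ℤ.+ inflow G k) each)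
    where
      each : ∀ k → + n ∣ (u k ℤ.+ inflow G k)
      each k with endpoint? k
      ... | yes e     = proj₁ (drains k) e
      ... | no not-end  = divides 0ℤ (trans (proj₂ (drains k) not-end) (sym (ℤP.*-zeroˡ (+ n))))
      total : sumℤ (λ k → u k ℤ.+ inflow G k) ≡ sumℤ u
      total = begin
          sumℤ (λ k → u k ℤ.+ inflow G k)    ≡⟨ sumℤ-+ u (inflow {suc (suc m)} G) ⟩
          sumℤ u ℤ.+ sumℤ (inflow {suc (suc m)} G)          ≡⟨ cong (λ t → sumℤ u ℤ.+ t) (sumℤ-inflow (suc (suc m)) 0 G) ⟩
          sumℤ u ℤ.+ (G (suc m) ℤ.- 0ℤ)       ≡⟨ cong (λ g → sumℤ u ℤ.+ (g ℤ.- 0ℤ)) G-end ⟩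
          sumℤ u ℤ.+ 0ℤ                       ≡⟨ ℤP.+-identityʳ (sumℤ u) ⟩
          sumℤ u                              ∎
        where open ≡-Reasoning

  drained-vertex : ∀ {u G} → (∀ k → Endpoint m k → (0ℤ ℤ.≤ u k) × (u k ℤ.< + n)) →
                   Drains u G → G (suc m) ≡ 0ℤ → Lip m G → IsVertex n m u
  drained-vertex {u} {G} ends drains G-end lip = ends , inner-range , ∣⇒∣ᵤ (drained-sum {u} {G} drains G-end)
    where
      inner-range : ∀ c → ¬ Endpoint m c → (-1ℤ ℤ.≤ u c) × (u c ℤ.≤ 1ℤ)
      inner-range c not-end with inner-index c not-end
      ... | k , c≡ , k<m = subst (λ x → (-1ℤ ℤ.≤ x) × (x ℤ.≤ 1ℤ)) (sym (drained-inner {u} {G} drains c k c≡ not-end)) (lip k k<m)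

  drained-by-zero : ∀ {u G} → IsVertex n m u → Drains u G → (∀ x → x ≤ suc m → G x ≡ 0ℤ) → ∀ k → u k ≡ 0ℤ
  drained-by-zero {u} {G} (ends , _ , _) drains vanishes k = by-kind (endpoint? k)
    where
      plain : u k ℤ.+ inflow G k ≡ u k
      plain = trans (cong (λ t → u k ℤ.+ t) (inflow-vanishes G vanishes k)) (ℤP.+-identityʳ (u k))
      by-kind : Dec (Endpoint m k) → u k ≡ 0ℤ
      by-kind (yes e)     = small-multiple (proj₁ (ends k e)) (proj₂ (ends k e)) (subst (+ n ∣_) plain (proj₁ (drains k) e))
      by-kind (no not-end)  = trans (sym plain) (proj₂ (drains k) not-end)

  mod-congruent : ∀ a → + n ∣ (+ (a %ℕ n) ℤ.- a)
  mod-congruent a = divides (ℤ.- (a /ℕ n))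
    (trans (cong (λ b → + (a %ℕ n) ℤ.- b) (a≡a%ℕn+[a/ℕn]*n a n))
      (solve 3 (λ r q N → r :- (r :+ q :* N) := (:- q) :* N) refl (+ (a %ℕ n)) (a /ℕ n) (+ n)))

  reduce : ∀ {k} → Dec (Endpoint m k) → ℤ → ℤ
  reduce (yes _) a = + (a %ℕ n)
  reduce (no _)  a = a

  shift : Tuple m → Op m → Tuple m
  shift u o k = reduce (endpoint? k) (u k ℤ.+ delta o k)

  shift-coords : ∀ u o k → CoordEq n m k (shift u o k) (u k ℤ.+ delta o k)
  shift-coords u o k with endpoint? k
  ... | yes e       = (λ _ → ∣⇒∣ᵤ (mod-congruent (u k ℤ.+ delta o k))) , (λ not-end → ⊥-elim (not-end e))
  ... | no not-end  = (λ e → ⊥-elim (not-end e)) , (λ _ → refl)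

  shift-ends : ∀ u o k → Endpoint m k → (0ℤ ℤ.≤ shift u o k) × (shift u o k ℤ.< + n)
  shift-ends u o k e with endpoint? k
  ... | yes _       = +≤+ z≤n , +<+ (n%ℕd<d (u k ℤ.+ delta o k) n)
  ... | no not-end  = ⊥-elim (not-end e)

  shift-step : ∀ {u G} o → Drains u G → G (suc m) ≡ 0ℤ → Lip m (λ x → G x ℤ.- opFlow o x) →
               Step n m o u (shift u o) × Drains (shift u o) (λ x → G x ℤ.- opFlow o x)
  shift-step {u} {G} o drains G-end lip' = (vertex , shift-coords u o) , drains'
    where
      G' : ℕ → ℤ
      G' x = G x ℤ.- opFlow o x
      split : ∀ k → inflow G k ≡ delta o k ℤ.+ inflow G' k
      split k = begin
          inflow G k                                         ≡⟨ solve 2 (λ I δ → I := δ :+ (I :- δ)) refl (inflow G k) (inflow (opFlow o) k) ⟩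
          inflow (opFlow o) k ℤ.+ (inflow G k ℤ.- inflow (opFlow o) k) ≡⟨ cong₂ (λ δ I → δ ℤ.+ I) (sym (delta-inflow o k)) (sym (inflow-- G (opFlow o) k)) ⟩
          delta o k ℤ.+ inflow G' k                          ∎
        where open ≡-Reasoning
      drains' : Drains (shift u o) G'
      drains' = proj₁ (drains-step {u} {shift u o} {o} {G} {G'} (shift-coords u o) split) drains
      vertex : IsVertex n m (shift u o)
      vertex = drained-vertex {G = G'} (shift-ends u o) drains' (cong₂ ℤ._-_ G-end (opFlow-beyond o)) lip'

  record Realised (u : Tuple m) (G : ℕ → ℤ) : Set where
    field
      word    : List (Op m)
      path    : PathTo0 n m u word
      short   : length word ≤ sumUpTo (λ x → ∣ G x ∣) m
      follows : Follows G word

  -- Greedy realisation: shift at a peak of |G| towards 0 and recurse on the reduced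
  -- flow (fuel bounds the total absolute flow, which drops by one in each step).
  realise : ∀ fuel G u → IsVertex n m u → Drains u G → G (suc m) ≡ 0ℤ →
            sumUpTo (λ x → ∣ G x ∣) m < fuel → Realised u G
  realise zero       G u _        _      _     ()
  realise (suc fuel) G u u-vertex drains G-end small with peak G
  ... | q , is-peak with sign-of (G (toℕ q))
  ...   | inj₁ zero-peak = record { word = [] ; path = here (drained-by-zero u-vertex drains vanishes)
                                  ; short = z≤n ; follows = λ _ _ () }
    where
      vanishes : ∀ x → x ≤ suc m → G x ≡ 0ℤ
      vanishes x x≤ with ℕP.m≤n⇒m<n∨m≡n x≤
      ... | inj₁ x≤m = ℤP.∣i∣≡0⇒i≡0 (ℕP.n≤0⇒n≡0 (subst (∣ G x ∣ ≤_) (cong ∣_∣ zero-peak) (is-peak x (ℕP.≤-pred x≤m))))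
      ... | inj₂ refl = G-end
  ...   | inj₂ (d , agrees) = record
      { word = op d q ∷ word ; path = step (shift u o) (proj₁ stepped) path
      ; short = subst (suc (length word) ≤_) (sym (shrink G d q agrees)) (s≤s short)
      ; follows = follows-cons G d q word agrees follows }
    where
      o : Op m
      o = op d q
      G' : ℕ → ℤ
      G' x = G x ℤ.- opFlow o x
      stepped : Step n m o u (shift u o) × Drains (shift u o) G'
      stepped = shift-step {u} {G} o drains G-end (lip-shift G d q is-peak agrees (vertex-lip {u} {G} u-vertex drains))
      fuel-left : sumUpTo (λ x → ∣ G' x ∣) m < fuel
      fuel-left = ℕP.≤-pred (subst (_< suc fuel) (shrink G d q agrees) small)
      open Realised (realise fuel G' (shift u o) (proj₁ (proj₁ stepped)) (proj₂ stepped)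
                             (cong₂ ℤ._-_ G-end (opFlow-beyond o)) fuel-left)

  realisation : ∀ {u G} → IsVertex n m u → Drains u G → G (suc m) ≡ 0ℤ → Realised u G
  realisation {u} {G} u-vertex drains G-end = realise _ G u u-vertex drains G-end ℕP.≤-refl

-- Lemma 5.11.  The realisation of the flow of a pivot path ws keeps its walls and has
-- length at most Σ_q |flow ws q|; a ←s_i and a →s_j in one P-interval would give a
-- reversal, making that sum smaller than length ws and contradicting minimality.
lemma5p11 : (n m : ℕ) → 2 ≤ n → 1 ≤ m → (v : Tuple m) → IsVertex n m v →
    (ws : List (Op m)) → IsPivotPath n m v ws →
    (a b : ℕ) → IsPInterval ws a b →
    (i j : Fin (suc m)) →
    a ≤ toℕ i → suc (toℕ i) ≤ b → a ≤ toℕ j → suc (toℕ j) ≤ b →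
    ¬ ((op shiftL i ∈ ws) × (op shiftR j ∈ ws))
lemma5p11 n m 2≤n _ v v-vertex ws (p , ws-path , p-wall , shortest) a b (_ , _ , _ , wall-free)
          i j a≤i i<b a≤j j<b (Li , Rj) =
  ℕP.<-irrefl refl (begin-strict
    length ws                        ≤⟨ shortest word path (walls-kept ws word p follows p-wall) ⟩
    length word                      ≤⟨ short ⟩
    sumUpTo (λ x → ∣ flow ws x ∣) m  <⟨ reversal-shortens ws (proj₁ reversal) (proj₂ reversal) ⟩
    length ws                        ∎)
  where
    open ℕP.≤-Reasoning
    instance
      n≢0 : NonZero n
      n≢0 = >-nonZero (ℕP.<⇒≤ 2≤n)
    open Words m
    open Realisation n m
    drains : Drains v (flow ws)
    drains = path-drains ws-path
    open Realised (realisation {v} {flow ws} v-vertex drains (flow-beyond ws))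
    reversal : Σ ℕ (Reversal ws)
    reversal = interval-reversal ws i j (vertex-lip {v} {flow ws} v-vertex drains) wall-free (a≤i , i<b) (a≤j , j<b) Li Rj
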